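{- For every small type $A$ of $\mathsf{PTT_1}$, $\vdash A=\overline{A^{d}}:\mathrm{U_0}$, where $A^{d}$ denotes the dual of $A$.
   Context: $\mathsf{PTT_1}$ is the following type theory. It has no basic types: types are generated from a countable set of type variables $\alpha,\alpha_1,\dots,\beta,\beta_1,\dots$ (standing for arbitrary, possibly dependent, basic types in $\mathrm{U_0}$). It extends the intensional fragment of Martin-Löf type theory with type constructors $\to,\times,+,\Pi,\Sigma$ (standard rules, term constructors $\lambda$, $\mathrm{Ap}$, $(\cdot,\cdot)$, $\mathrm{fst}$, $\mathrm{snd}$, $\mathrm{inl}$, $\mathrm{inr}$, $D$, $E$, computation rules) and universes $\mathrm{U_0}:\mathrm{U_1}$ ($\mathrm{U_1}$ closed under $\to$; $\mathrm{U_0}$ closed under all constructors below; types in $\mathrm{U_0}$ are small). Added: opposite types $\overline{A}:\mathrm{U_0}$ for $A:\mathrm{U_0}$ and co-function types $B\leftarrow A:\mathrm{U_0}$ for $A,B:\mathrm{U_0}$, with rules: from $a:A$ infer $a:\overline{\overline{A}}$ and conversely; from $a:A$, $b:\overline B$ infer $(a,b):\overline{A\to B}$; from $c:\overline{A\to B}$ infer $\mathrm{fst}(c):A$, $\mathrm{snd}(c):\overline B$; from $a:\overline A$ infer $\mathrm{inl}(a):\overline{A\times B}$; from $b:\overline B$ infer $\mathrm{inr}(b):\overline{A\times B}$; from $c:\overline{A\times B}$, $d(x):C(\mathrm{inl}(x))$ [$x:\overline A$], $e(y):C(\mathrm{inr}(y))$ [$y:\overline B$] infer $D(c,x.d,y.e):C(c)$;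 from $a:\overline A$, $b:\overline B$ infer $(a,b):\overline{A+B}$; from $c:\overline{A+B}$ infer $\mathrm{fst}(c):\overline A$, $\mathrm{snd}(c):\overline B$; from $a:A$, $b:\overline{B(a)}$ infer $(a,b):\overline{\Pi x:A.B(x)}$; from $c:\overline{\Pi x:A.B(x)}$, $d(x,y):C((x,y))$ [$x:A,y:\overline{B(x)}$] infer $E(c,(x,y).d):C(c)$; from $b(x):\overline{B(x)}$ [$x:A$] infer $\lambda x.b:\overline{\Sigma x:A.B(x)}$; from $c:\overline{\Sigma x:A.B(x)}$, $a:A$ infer $\mathrm{Ap}(c,a):\overline{B(a)}$; from $a:\overline A$, $b:B$ infer $(a,b):B\leftarrow A$; from $c:B\leftarrow A$ infer $\mathrm{fst}(c):\overline A$, $\mathrm{snd}(c):B$; from $b(x):\overline B$ [$x:\overline A$] infer $\lambda x.b:\overline{B\leftarrow A}$; from $c:\overline{B\leftarrow A}$, $a:\overline A$ infer $\mathrm{Ap}(c,a):\overline B$. Also: the usual computation rules; eta/co-eta rules $\lambda x.\mathrm{Ap}(c,x)=c:W$ ($W\in\{A\to B,\Pi x:A.B(x),\overline{B\leftarrow A},\overline{\Sigma x:A.B(x)}\}$), $(\mathrm{fst}(c),\mathrm{snd}(c))=c:X$ ($X\in\{A\times B,B\leftarrow A,\Sigma x:A.B(x),\overline{A+B},\overline{A\to B},\overline{\Pi x:A.B(x)}\}$), $D(c,x.\mathrm{inl}(x),y.\mathrm{inr}(y))=c:Y$ ($Y\in\{A+B,\overline{A\times B}\}$), $E(c,(x,y).(x,y))=c:Z$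 ($Z\in\{\Sigma x:A.B(x),\overline{\Pi x:A.B(x)}\}$); and the type equality rules (for small $A,B$): $\overline{A\to B}=\overline B\leftarrow\overline A:\mathrm{U_0}$, $\overline{B\leftarrow A}=\overline A\to\overline B:\mathrm{U_0}$, $\overline{A\times B}=\overline A+\overline B:\mathrm{U_0}$, $\overline{A+B}=\overline A\times\overline B:\mathrm{U_0}$, $\overline{\Pi x:A.B}=\Sigma x:A.\overline B:\mathrm{U_0}$, $\overline{\Sigma x:A.B}=\Pi x:A.\overline B:\mathrm{U_0}$, $\overline{\overline A}=A:\mathrm{U_0}$. In $\Pi x:A.B$ and $\Sigma x:A.B$, $A$ is called the generating type. The dual $A^d$ of a type $A$ is obtained by exchanging $\to$ and $\leftarrow$ while swapping the left-hand and right-hand argument types of these constructors (so $C\to D$ becomes $D\leftarrow C$ and $D\leftarrow C$ becomes $C\to D$, recursively), exchanging $\times$ and $+$, exchanging $\Pi$ and $\Sigma$, and replacing each type variable $\alpha$ by $\overline{\alpha}$, leaving generating types unchanged (and leaving occurrences of the opposite constructor in place). -}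

module Defs where

open import Data.Nat using (ℕ; suc)
open import Data.List using (List)

-- Raw syntax of the SMALL types of PTT_1 (types of U_0), in de Bruijn style:
-- `Ty Tm n` are types in a context of n term variables.  `Tm n` is the
-- (arbitrary) syntax of terms with n free variables; it only occurs as the
-- arguments of (possibly dependent) basic type variables α(t₁,…,tₖ).
data Ty (Tm : ℕ → Set) : ℕ → Set where
  tv   : ∀ {n} → ℕ → List (Tm n) → Ty Tm n
  _⇒_  : ∀ {n} → Ty Tm n → Ty Tm n → Ty Tm n
  _⇐_  : ∀ {n} → Ty Tm n → Ty Tm n → Ty Tm n        -- B ⇐ A  is the co-function type  B ← A
  _⊗_  : ∀ {n} → Ty Tm n → Ty Tm n → Ty Tm n
  _⊕_  : ∀ {n} → Ty Tm n → Ty Tm n → Ty Tm n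
  Pi   : ∀ {n} → Ty Tm n → Ty Tm (suc n) → Ty Tm n  -- Π x:A. B(x)   (A generating type)
  Sg   : ∀ {n} → Ty Tm n → Ty Tm (suc n) → Ty Tm n  -- Σ x:A. B(x)   (A generating type)
  op   : ∀ {n} → Ty Tm n → Ty Tm n

infixr 30 _⇒_ _⇐_
infixr 35 _⊕_
infixr 40 _⊗_

dual : ∀ {Tm n} → Ty Tm n → Ty Tm n
dual (tv i ts) = op (tv i ts)
dual (A ⇒ B)   = dual B ⇐ dual A
dual (B ⇐ A)   = dual A ⇒ dual B
dual (A ⊗ B)   = dual A ⊕ dual B
dual (A ⊕ B)   = dual A ⊗ dual B
dual (Pi A B)  = Sg A (dual B)
dual (Sg A B)  = Pi A (dual B)
dual (op A)    = op (dual A)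

-- Derivable judgmental equality  ⊢ A = B : U_0  between small types:
-- an equivalence relation, congruent for all type constructors
-- (including under binders), generated by the type equality rules of PTT_1.
infix 4 _≐_
data _≐_ {Tm : ℕ → Set} : ∀ {n} → Ty Tm n → Ty Tm n → Set where
  ≐-refl  : ∀ {n} {A : Ty Tm n} → A ≐ A
  ≐-sym   : ∀ {n} {A B : Ty Tm n} → A ≐ B → B ≐ A
  ≐-trans : ∀ {n} {A B C : Ty Tm n} → A ≐ B → B ≐ C → A ≐ C
  ⇒-cong  : ∀ {n} {A A' B B' : Ty Tm n} → A ≐ A' → B ≐ B' → (A ⇒ B) ≐ (A' ⇒ B')
  ⇐-cong  : ∀ {n} {A A' B B' : Ty Tm n} → B ≐ B' → A ≐ A' → (B ⇐ A) ≐ (B' ⇐ A')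
  ⊗-cong  : ∀ {n} {A A' B B' : Ty Tm n} → A ≐ A' → B ≐ B' → (A ⊗ B) ≐ (A' ⊗ B')
  ⊕-cong  : ∀ {n} {A A' B B' : Ty Tm n} → A ≐ A' → B ≐ B' → (A ⊕ B) ≐ (A' ⊕ B')
  Pi-cong : ∀ {n} {A A' : Ty Tm n} {B B' : Ty Tm (suc n)} → A ≐ A' → B ≐ B' → Pi A B ≐ Pi A' B'
  Sg-cong : ∀ {n} {A A' : Ty Tm n} {B B' : Ty Tm (suc n)} → A ≐ A' → B ≐ B' → Sg A B ≐ Sg A' B'
  op-cong : ∀ {n} {A A' : Ty Tm n} → A ≐ A' → op A ≐ op A'
  op-⇒    : ∀ {n} {A B : Ty Tm n} → op (A ⇒ B) ≐ (op B ⇐ op A)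
  op-⇐    : ∀ {n} {A B : Ty Tm n} → op (B ⇐ A) ≐ (op A ⇒ op B)
  op-⊗    : ∀ {n} {A B : Ty Tm n} → op (A ⊗ B) ≐ (op A ⊕ op B)
  op-⊕    : ∀ {n} {A B : Ty Tm n} → op (A ⊕ B) ≐ (op A ⊗ op B)
  op-Pi   : ∀ {n} {A : Ty Tm n} {B : Ty Tm (suc n)} → op (Pi A B) ≐ Sg A (op B)
  op-Sg   : ∀ {n} {A : Ty Tm n} {B : Ty Tm (suc n)} → op (Sg A B) ≐ Pi A (op B)
  op-op   : ∀ {n} {A : Ty Tm n} → op (op A) ≐ A

{-# OPTIONS --safe #-}
module Submission where

open import Data.Nat using (ℕ)
open import Defs

-- Each type equality rule says that op distributes over a constructor as its
-- dual constructor, with the arguments in the dual order: op (A ⇒ B) = op B ⇐ op A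
-- is exactly the clause dual (A ⇒ B) = dual B ⇐ dual A read backwards.  Hence
-- op ∘ dual is the identity up to ≐, by induction on the type: a type variable
-- α becomes op (op α) = α, and generating types need no step since both dual
-- and the Π/Σ rules leave them in place.

≐-op-dual : ∀ {Tm : ℕ → Set} {n : ℕ} (A : Ty Tm n) → A ≐ op (dual A)
≐-op-dual (tv i ts) = ≐-sym op-op
≐-op-dual (A ⇒ B)   = ≐-trans (⇒-cong (≐-op-dual A) (≐-op-dual B)) (≐-sym op-⇐)
≐-op-dual (B ⇐ A)   = ≐-trans (⇐-cong (≐-op-dual B) (≐-op-dual A)) (≐-sym op-⇒)
≐-op-dual (A ⊗ B)   = ≐-trans (⊗-cong (≐-op-dual A) (≐-op-dual B)) (≐-sym op-⊕)
≐-op-dual (A ⊕ B)   = ≐-trans (⊕-cong (≐-op-dual A) (≐-op-dual B)) (≐-sym op-⊗)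
≐-op-dual (Pi A B)  = ≐-trans (Pi-cong ≐-refl (≐-op-dual B)) (≐-sym op-Sg)
≐-op-dual (Sg A B)  = ≐-trans (Sg-cong ≐-refl (≐-op-dual B)) (≐-sym op-Pi)
≐-op-dual (op A)    = op-cong (≐-op-dual A)

mainTheorem5 : (Tm : ℕ → Set) (n : ℕ) (A : Ty Tm n) → A ≐ op (dual A)
mainTheorem5 Tm n A = ≐-op-dual A
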